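{- For every integer $k\ge0$, $$f_{1,6(k+2)}=E_6\,f_{1,6(k+1)}+\mu_k\,\Delta\, f_{1,6k},\qquad f_{1,6(k+2)+2}=E_6\,f_{1,6(k+1)+2}+\mu_k^*\,\Delta\, f_{1,6k+2}.$$
   Context: Let $q=e^{2\pi i z}$, $D=q\frac{d}{dq}=\frac{1}{2\pi i}\frac{d}{dz}$, and let $E_2,E_4,E_6$ be the normalized Eisenstein series $E_2=1-24\sum\sigma_1(n)q^n$, $E_4=1+240\sum\sigma_3(n)q^n$, $E_6=1-504\sum\sigma_5(n)q^n$. Let $\Delta=q\prod_{n\ge1}(1-q^n)^{24}=(E_4^3-E_6^2)/1728$ and $\Delta^{1/2}=q^{1/2}\prod_{n\ge1}(1-q^n)^{12}$. For $k\ge1$ let $\mu_k=\frac{12(6k+1)(6k+5)}{k(k+1)}$ and $\mu_k^*=\frac{12(6k-1)(6k+7)}{k(k+1)}$, and set $\mu_0=\mu_0^*=-1$. Define polynomials by $P_0=1$, $P_1=x$, $P_{k+1}=xP_k+\mu_kP_{k-1}$; $Q_0=0$, $Q_1=1$, $Q_{k+1}=xQ_k+\mu_kQ_{k-1}$; $P_0^*=1$, $P^*_1=x$, $P^*_{k+1}=xP^*_k+\mu^*_kP^*_{k-1}$; $Q^*_0=0$, $Q^*_1=1$, $Q^*_{k+1}=xQ^*_k+\mu^*_kQ^*_{k-1}$ (for $k\ge1$). For $k\ge1$ put $f_{1,6k}=\Delta^{\frac{k-1}{2}}P_{k-1}\big(\tfrac{E_6}{\Delta^{1/2}}\big)\tfrac{D(E_4)}{240}-\Delta^{\frac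 k2}Q_{k-1}\big(\tfrac{E_6}{\Delta^{1/2}}\big)$ and $f_{1,6k+2}=\Delta^{\frac{k-1}{2}}P^*_{k-1}\big(\tfrac{E_6}{\Delta^{1/2}}\big)\big(-\tfrac{D(E_6)}{504}\big)-\Delta^{\frac k2}Q^*_{k-1}\big(\tfrac{E_6}{\Delta^{1/2}}\big)E_2$, and set $f_{1,0}=1$ and $f_{1,2}=E_2$. -}

module Defs where

open import Data.Nat as ℕ using (ℕ; zero; suc)
open import Data.Nat.Divisibility using (_∣?_)
open import Data.Integer as ℤ using (ℤ; +_)
open import Data.Rational using (ℚ; 0ℚ; 1ℚ; _+_; _*_; -_; _-_; _/_)
open import Data.Bool using (if_then_else_)
open import Data.List using (List; []; _∷_; map; filter; upTo; foldr)

-- Formal power series in t = q^(1/2) with rational coefficients.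
-- A series is its coefficient function: (f m) = coefficient of t^m.

Series : Set
Series = ℕ → ℚ

ℕtoℚ : ℕ → ℚ
ℕtoℚ n = (+ n) / 1

sumℚ : List ℚ → ℚ
sumℚ = foldr _+_ 0ℚ

0S : Series
0S _ = 0ℚ

1S : Series
1S zero    = 1ℚ
1S (suc _) = 0ℚ

_+S_ : Series → Series → Series
(f +S g) m = f m + g m

_•S_ : ℚ → Series → Series
(c •S f) m = c * f m

_*S_ : Series → Series → Series
(f *S g) m = sumℚ (map (λ i → f i * g (m ℕ.∸ i)) (upTo (suc m)))

infixl 6 _+S_
infixl 7 _*S_
infixr 7 _•S_

_^S_ : Series → ℕ → Series
f ^S zero  = 1S
f ^S suc n = f *S (f ^S n)

tPow : ℕ → Series
tPow j m = if j ℕ.≡ᵇ m then 1ℚ else 0ℚ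

qToT : (ℕ → ℚ) → Series
qToT f zero          = f zero
qToT f (suc zero)    = 0ℚ
qToT f (suc (suc m)) = qToT (λ n → f (suc n)) m

-- D = q d/dq = (1/2) t d/dt : t^m ↦ (m/2) t^m
D : Series → Series
D f m = ((+ m) / 2) * f m

σ : ℕ → ℕ → ℕ
σ r n = foldr ℕ._+_ 0 (map (λ d → d ℕ.^ r) (filter (_∣? n) (map suc (upTo n))))

eisQ : ℤ → ℕ → ℕ → ℚ
eisQ c r zero    = 1ℚ
eisQ c r (suc n) = (c / 1) * ℕtoℚ (σ r (suc n))

E₂ E₄ E₆ : Series
E₂ = qToT (eisQ (ℤ.- (+ 24)) 1)
E₄ = qToT (eisQ (+ 240) 3)
E₆ = qToT (eisQ (ℤ.- (+ 504)) 5)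

oneMinusQPow : ℕ → Series
oneMinusQPow n = 1S +S ((- 1ℚ) •S tPow (2 ℕ.* n))

prodS : ℕ → ℕ → Series
prodS e zero    = 1S
prodS e (suc N) = (oneMinusQPow (suc N) ^S e) *S prodS e N

-- The coefficient of t^m in the formal infinite product only depends on the
-- factors with 2n ≤ m, so truncating at N = m is exact.
-- Δ^(1/2) = q^(1/2) ∏ (1-q^n)^12 = t ∏ (1 - t^(2n))^12
Δhalf : Series
Δhalf zero    = 0ℚ
Δhalf (suc m) = prodS 12 (suc m) m

Δ : Series
Δ zero          = 0ℚ
Δ (suc zero)    = 0ℚ
Δ (suc (suc m)) = prodS 24 (suc (suc m)) m

μ : ℕ → ℚ
μ zero      = - 1ℚ
μ (suc j)   = (+ (12 ℕ.* (6 ℕ.* k ℕ.+ 1) ℕ.* (6 ℕ.* k ℕ.+ 5))) / (k ℕ.* suc k)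
  where k = suc j

μ* : ℕ → ℚ
μ* zero     = - 1ℚ
μ* (suc j)  = (+ (12 ℕ.* (6 ℕ.* k ℕ.∸ 1) ℕ.* (6 ℕ.* k ℕ.+ 7))) / (k ℕ.* suc k)
  where k = suc j

-- Polynomials in x over ℚ as ascending coefficient lists.

Poly : Set
Poly = List ℚ

_+P_ : Poly → Poly → Poly
[]       +P q        = q
(a ∷ p)  +P []       = a ∷ p
(a ∷ p)  +P (b ∷ q)  = (a + b) ∷ (p +P q)

scaleP : ℚ → Poly → Poly
scaleP c = map (c *_)

mulX : Poly → Poly
mulX p = 0ℚ ∷ p

polySeq : (ℕ → ℚ) → Poly → Poly → ℕ → Poly
polySeq m a b zero          = a
polySeq m a b (suc zero)    = b
polySeq m a b (suc (suc k)) =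
  mulX (polySeq m a b (suc k)) +P scaleP (m (suc k)) (polySeq m a b k)

P P* Q Q* : ℕ → Poly
P  = polySeq μ  (1ℚ ∷ []) (0ℚ ∷ 1ℚ ∷ [])
Q  = polySeq μ  []        (1ℚ ∷ [])
P* = polySeq μ* (1ℚ ∷ []) (0ℚ ∷ 1ℚ ∷ [])
Q* = polySeq μ* []        (1ℚ ∷ [])

-- Homogenised evaluation: for p = Σ_j c_j x^j with deg p ≤ d,
--   hom d p X Y = Y^d · p(X / Y) = Σ_j c_j X^j Y^(d-j).
hom : ℕ → Poly → Series → Series → Series
hom d []      X Y = 0S
hom d (c ∷ p) X Y = (c •S (Y ^S d)) +S (X *S hom (d ℕ.∸ 1) p X Y)

-- f_{1,6k} and f_{1,6k+2}
-- Δ^((k-1)/2) P_{k-1}(E6/Δ^(1/2)) = hom (k-1) P_{k-1} E6 Δ^(1/2)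
-- Δ^(k/2)     Q_{k-1}(E6/Δ^(1/2)) = hom k     Q_{k-1} E6 Δ^(1/2)

f6 : ℕ → Series
f6 zero    = 1S
f6 (suc j) =
  (hom j (P j) E₆ Δhalf *S (((+ 1) / 240) •S D E₄))
  +S ((- 1ℚ) •S hom (suc j) (Q j) E₆ Δhalf)

f6+2 : ℕ → Series
f6+2 zero    = E₂
f6+2 (suc j) =
  (hom j (P* j) E₆ Δhalf *S ((- ((+ 1) / 504)) •S D E₆))
  +S ((- 1ℚ) •S (hom (suc j) (Q* j) E₆ Δhalf *S E₂))

-- Write X = E₆, Y = Δ^(1/2) and hom d R for the homogenisation Y^d R(X/Y).
-- Both families have the shape  f_{k+1} = L(hom k P_k, hom (k+1) Q_k)  with
-- L(H, G) = H·A − G·B  for fixed series A, B, where (P_k) and (Q_k) obey the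
-- recurrence R_{k+1} = x R_k + m_k R_{k-1}.  The argument has four parts:
--   1. formal power series over ℚ form a commutative ring (up to coefficientwise
--      equality ≈), proved from the recursive description of the Cauchy product;
--   2. Δ^(1/2) · Δ^(1/2) = Δ, since the truncated products defining both
--      series stabilise coefficientwise;
--   3. homogenisation is linear, turns x·R into X·R, and raising the degree
--      by two multiplies by Y²; with the bounds deg P_k ≤ k, deg Q_k < k this
--      turns the polynomial recurrence into hom R_{k+2} = X hom R_{k+1} + m Y² hom R_k;
--   4. L is linear over series, so the recurrence passes to f; the first step
--      (k = 0, m_0 = −1) is checked directly from P_0, P_1, Q_0, Q_1.
-- Corollary 3.2 is then part 4 instantiated at (A, B) = (D E₄/240, 1) and
-- (−D E₆/504, E₂), with Y² replaced by Δ using part 2.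

module Submission where

open import Defs
open import Data.Nat using (ℕ; _+_)
open import Data.Product using (_×_)
open import Relation.Binary.PropositionalEquality using (_≡_)

open import Data.Nat as ℕ using (zero; suc; _≤_; _<_; _≤′_; z≤n; s≤s; ≤′-reflexive; ≤′-step)
import Data.Nat.Properties as ℕP
open import Data.Product using (_,_)
open import Data.Integer using (+_)
open import Data.Rational as ℚ using (ℚ; 0ℚ; 1ℚ; -_)
import Data.Rational.Properties as ℚP
open import Data.Rational.Solver using (module +-*-Solver)
open import Data.List using ([]; _∷_; length; applyUpTo)
import Data.List.Properties as ListP
open import Relation.Binary.Bundles using (Setoid)
open import Relation.Binary.PropositionalEquality using (refl; sym; trans; cong; cong₂; module ≡-Reasoning)
import Relation.Binary.Reasoning.Setoid as SetoidReasoning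

open +-*-Solver using (solve; _:=_; _:+_; _:*_)

-- Part 1: the ring of formal power series.

-- Coefficientwise equality; series are functions, so identities hold up to ≈.
_≈_ : Series → Series → Set
f ≈ g = ∀ m → f m ≡ g m
infix 4 _≈_

≈-setoid : Setoid _ _
≈-setoid = record
  { Carrier       = Series
  ; _≈_           = _≈_
  ; isEquivalence = record
    { refl  = λ _ → refl
    ; sym   = λ f≈g m → sym (f≈g m)
    ; trans = λ f≈g g≈h m → trans (f≈g m) (g≈h m)
    }
  }

open Setoid ≈-setoid using () renaming (refl to ≈-refl; sym to ≈-sym; trans to ≈-trans)
module ≈-Reasoning = SetoidReasoning ≈-setoid

tl : Series → Series
tl f m = f (suc m)

*S-sum : ∀ f g m → (f *S g) m ≡ sumℚ (applyUpTo (λ i → f i ℚ.* g (m ℕ.∸ i)) (suc m))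
*S-sum f g m = cong sumℚ (ListP.map-upTo (λ i → f i ℚ.* g (m ℕ.∸ i)) (suc m))

-- The recursive description of the product used in every proof below:
-- fg = f₀g + t·(tl f)·g.
*S-coeff₀ : ∀ f g → (f *S g) 0 ≡ f 0 ℚ.* g 0
*S-coeff₀ f g = ℚP.+-identityʳ (f 0 ℚ.* g 0)

*S-coeffₛ : ∀ f g m → (f *S g) (suc m) ≡ f 0 ℚ.* g (suc m) ℚ.+ (tl f *S g) m
*S-coeffₛ f g m = trans (*S-sum f g (suc m)) (cong (f 0 ℚ.* g (suc m) ℚ.+_) (sym (*S-sum (tl f) g m)))

+-cong : ∀ {f f′ g g′} → f ≈ f′ → g ≈ g′ → f +S g ≈ f′ +S g′
+-cong f≈ g≈ m = cong₂ ℚ._+_ (f≈ m) (g≈ m)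

•-cong : ∀ c {f f′} → f ≈ f′ → c •S f ≈ c •S f′
•-cong c f≈ m = cong (c ℚ.*_) (f≈ m)

*-cong : ∀ {f f′ g g′} → f ≈ f′ → g ≈ g′ → f *S g ≈ f′ *S g′
*-cong {f} {f′} {g} {g′} f≈ g≈ zero =
  trans (*S-coeff₀ f g) (trans (cong₂ ℚ._*_ (f≈ 0) (g≈ 0)) (sym (*S-coeff₀ f′ g′)))
*-cong {f} {f′} {g} {g′} f≈ g≈ (suc m) = trans (*S-coeffₛ f g m) (trans
  (cong₂ ℚ._+_ (cong₂ ℚ._*_ (f≈ 0) (g≈ (suc m))) (*-cong (λ i → f≈ (suc i)) g≈ m))
  (sym (*S-coeffₛ f′ g′ m)))

*-zeroˡ : ∀ g → 0S *S g ≈ 0S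
*-zeroˡ g zero    = trans (*S-coeff₀ 0S g) (ℚP.*-zeroˡ (g 0))
*-zeroˡ g (suc m) = trans (*S-coeffₛ 0S g m)
  (trans (cong₂ ℚ._+_ (ℚP.*-zeroˡ (g (suc m))) (*-zeroˡ g m)) (ℚP.+-identityˡ 0ℚ))

*-identityˡ : ∀ g → 1S *S g ≈ g
*-identityˡ g zero    = trans (*S-coeff₀ 1S g) (ℚP.*-identityˡ (g 0))
*-identityˡ g (suc m) = trans (*S-coeffₛ 1S g m)
  (trans (cong₂ ℚ._+_ (ℚP.*-identityˡ (g (suc m))) (*-zeroˡ g m)) (ℚP.+-identityʳ (g (suc m))))

*-distribˡ : ∀ f g h → f *S (g +S h) ≈ f *S g +S f *S h
*-distribˡ f g h zero = trans (*S-coeff₀ f (g +S h))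
  (trans (ℚP.*-distribˡ-+ (f 0) (g 0) (h 0)) (sym (cong₂ ℚ._+_ (*S-coeff₀ f g) (*S-coeff₀ f h))))
*-distribˡ f g h (suc m) = trans (*S-coeffₛ f (g +S h) m) (trans
  (cong (f 0 ℚ.* (g (suc m) ℚ.+ h (suc m)) ℚ.+_) (*-distribˡ (tl f) g h m))
  (trans (solve 5 (λ a x y u v → a :* (x :+ y) :+ (u :+ v) := (a :* x :+ u) :+ (a :* y :+ v)) refl
            (f 0) (g (suc m)) (h (suc m)) ((tl f *S g) m) ((tl f *S h) m))
         (sym (cong₂ ℚ._+_ (*S-coeffₛ f g m) (*S-coeffₛ f h m)))))

*-scaleʳ : ∀ c f g → f *S (c •S g) ≈ c •S (f *S g)
*-scaleʳ c f g zero = trans (*S-coeff₀ f (c •S g))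
  (trans (solve 3 (λ c a x → a :* (c :* x) := c :* (a :* x)) refl c (f 0) (g 0))
         (cong (c ℚ.*_) (sym (*S-coeff₀ f g))))
*-scaleʳ c f g (suc m) = trans (*S-coeffₛ f (c •S g) m) (trans
  (cong (f 0 ℚ.* (c ℚ.* g (suc m)) ℚ.+_) (*-scaleʳ c (tl f) g m))
  (trans (solve 4 (λ c a x u → a :* (c :* x) :+ c :* u := c :* (a :* x :+ u)) refl
            c (f 0) (g (suc m)) ((tl f *S g) m))
         (cong (c ℚ.*_) (sym (*S-coeffₛ f g m)))))

-- Commutativity: unfolding fg and gf twice each exposes the same two boundary
-- terms f₀g_{m+2}, g₀f_{m+2} and a product of tails; recursion at m + 1 and m.
*-comm : ∀ f g → f *S g ≈ g *S f
*-comm f g zero = trans (*S-coeff₀ f g) (trans (ℚP.*-comm (f 0) (g 0)) (sym (*S-coeff₀ g f)))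
*-comm f g (suc zero) = begin
  (f *S g) 1                           ≡⟨ *S-coeffₛ f g 0 ⟩
  f 0 ℚ.* g 1 ℚ.+ (tl f *S g) 0        ≡⟨ cong (f 0 ℚ.* g 1 ℚ.+_) (*S-coeff₀ (tl f) g) ⟩
  f 0 ℚ.* g 1 ℚ.+ f 1 ℚ.* g 0          ≡⟨ solve 4 (λ a b x y → a :* y :+ b :* x := x :* b :+ y :* a) refl
                                              (f 0) (f 1) (g 0) (g 1) ⟩
  g 0 ℚ.* f 1 ℚ.+ g 1 ℚ.* f 0          ≡⟨ cong (g 0 ℚ.* f 1 ℚ.+_) (*S-coeff₀ (tl g) f) ⟨
  g 0 ℚ.* f 1 ℚ.+ (tl g *S f) 0        ≡⟨ *S-coeffₛ g f 0 ⟨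
  (g *S f) 1                           ∎
  where open ≡-Reasoning
*-comm f g (suc (suc m)) = begin
  (f *S g) (2 + m)                                     ≡⟨ *S-coeffₛ f g (suc m) ⟩
  a ℚ.+ (tl f *S g) (suc m)                            ≡⟨ cong (a ℚ.+_) (*-comm (tl f) g (suc m)) ⟩
  a ℚ.+ (g *S tl f) (suc m)                            ≡⟨ cong (a ℚ.+_) (*S-coeffₛ g (tl f) m) ⟩
  a ℚ.+ (b ℚ.+ (tl g *S tl f) m)                       ≡⟨ cong (λ z → a ℚ.+ (b ℚ.+ z)) (*-comm (tl g) (tl f) m) ⟩
  a ℚ.+ (b ℚ.+ (tl f *S tl g) m)                       ≡⟨ solve 3 (λ a b u → a :+ (b :+ u) := b :+ (a :+ u)) refl
                                                            a b ((tl f *S tl g) m) ⟩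
  b ℚ.+ (a ℚ.+ (tl f *S tl g) m)                       ≡⟨ cong (b ℚ.+_) (*S-coeffₛ f (tl g) m) ⟨
  b ℚ.+ (f *S tl g) (suc m)                            ≡⟨ cong (b ℚ.+_) (*-comm (tl g) f (suc m)) ⟨
  b ℚ.+ (tl g *S f) (suc m)                            ≡⟨ *S-coeffₛ g f (suc m) ⟨
  (g *S f) (2 + m)                                     ∎
  where
  open ≡-Reasoning
  a b : ℚ
  a = f 0 ℚ.* g (2 + m)
  b = g 0 ℚ.* f (2 + m)

*-distribʳ : ∀ f g h → (f +S g) *S h ≈ f *S h +S g *S h
*-distribʳ f g h = begin
  (f +S g) *S h      ≈⟨ *-comm (f +S g) h ⟩
  h *S (f +S g)      ≈⟨ *-distribˡ h f g ⟩
  h *S f +S h *S g   ≈⟨ +-cong (*-comm h f) (*-comm h g) ⟩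
  f *S h +S g *S h   ∎
  where open ≈-Reasoning

*-scaleˡ : ∀ c f g → (c •S f) *S g ≈ c •S (f *S g)
*-scaleˡ c f g = ≈-trans (*-comm (c •S f) g) (≈-trans (*-scaleʳ c g f) (•-cong c (*-comm g f)))

*-zeroʳ : ∀ g → g *S 0S ≈ 0S
*-zeroʳ g = ≈-trans (*-comm g 0S) (*-zeroˡ g)

*-identityʳ : ∀ g → g *S 1S ≈ g
*-identityʳ g = ≈-trans (*-comm g 1S) (*-identityˡ g)

tl-* : ∀ f g → tl (f *S g) ≈ tl f *S g +S f 0 •S tl g
tl-* f g m = trans (*S-coeffₛ f g m) (ℚP.+-comm (f 0 ℚ.* g (suc m)) ((tl f *S g) m))

*-assoc : ∀ f g h → (f *S g) *S h ≈ f *S (g *S h)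
*-assoc f g h zero = trans (*S-coeff₀ (f *S g) h) (trans (cong (ℚ._* h 0) (*S-coeff₀ f g))
  (trans (ℚP.*-assoc (f 0) (g 0) (h 0))
         (trans (cong (f 0 ℚ.*_) (sym (*S-coeff₀ g h))) (sym (*S-coeff₀ f (g *S h))))))
*-assoc f g h (suc m) = begin
  ((f *S g) *S h) (suc m)                                         ≡⟨ *S-coeffₛ (f *S g) h m ⟩
  (f *S g) 0 ℚ.* h (suc m) ℚ.+ (tl (f *S g) *S h) m               ≡⟨ cong₂ ℚ._+_ (cong (ℚ._* h (suc m)) (*S-coeff₀ f g)) tail-part ⟩
  (f 0 ℚ.* g 0) ℚ.* h (suc m) ℚ.+ (u ℚ.+ f 0 ℚ.* v)               ≡⟨ solve 5 (λ a b x u v → (a :* b) :* x :+ (u :+ a :* v) := a :* (b :* x :+ v) :+ u) refl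
                                                                       (f 0) (g 0) (h (suc m)) u v ⟩
  f 0 ℚ.* (g 0 ℚ.* h (suc m) ℚ.+ v) ℚ.+ u                         ≡⟨ cong (λ z → f 0 ℚ.* z ℚ.+ u) (*S-coeffₛ g h m) ⟨
  f 0 ℚ.* (g *S h) (suc m) ℚ.+ (tl f *S (g *S h)) m               ≡⟨ *S-coeffₛ f (g *S h) m ⟨
  (f *S (g *S h)) (suc m)                                         ∎
  where
  open ≡-Reasoning
  u = (tl f *S (g *S h)) m
  v = (tl g *S h) m
  tail-part : (tl (f *S g) *S h) m ≡ u ℚ.+ f 0 ℚ.* v
  tail-part = trans (*-cong (tl-* f g) (≈-refl {h}) m) (trans (*-distribʳ (tl f *S g) (f 0 •S tl g) h m)
    (cong₂ ℚ._+_ (*-assoc (tl f) g h m) (*-scaleˡ (f 0) (tl g) h m)))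

*-left-comm : ∀ f g h → f *S (g *S h) ≈ g *S (f *S h)
*-left-comm f g h = begin
  f *S (g *S h)    ≈⟨ *-assoc f g h ⟨
  (f *S g) *S h    ≈⟨ *-cong (*-comm f g) (≈-refl {h}) ⟩
  (g *S f) *S h    ≈⟨ *-assoc g f h ⟩
  g *S (f *S h)    ∎
  where open ≈-Reasoning

*-interchange : ∀ a b c d → (a *S b) *S (c *S d) ≈ (a *S c) *S (b *S d)
*-interchange a b c d = begin
  (a *S b) *S (c *S d)   ≈⟨ *-assoc a b (c *S d) ⟩
  a *S (b *S (c *S d))   ≈⟨ *-cong (≈-refl {a}) (*-left-comm b c d) ⟩
  a *S (c *S (b *S d))   ≈⟨ *-assoc a c (b *S d) ⟨
  (a *S c) *S (b *S d)   ∎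
  where open ≈-Reasoning

^S-+ : ∀ u a b → (u ^S a) *S (u ^S b) ≈ u ^S (a + b)
^S-+ u zero    b = *-identityˡ (u ^S b)
^S-+ u (suc a) b = ≈-trans (*-assoc u (u ^S a) (u ^S b)) (*-cong (≈-refl {u}) (^S-+ u a b))

-- Part 2: Δ^(1/2) · Δ^(1/2) = Δ.

shift : Series → Series
shift f zero    = 0ℚ
shift f (suc m) = f m

shift-cong : ∀ {f g} → f ≈ g → shift f ≈ shift g
shift-cong f≈g zero    = refl
shift-cong f≈g (suc m) = f≈g m

shift-*ˡ : ∀ f g → shift f *S g ≈ shift (f *S g)
shift-*ˡ f g zero    = trans (*S-coeff₀ (shift f) g) (ℚP.*-zeroˡ (g 0))
shift-*ˡ f g (suc m) = trans (*S-coeffₛ (shift f) g m)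
  (trans (cong (ℚ._+ (f *S g) m) (ℚP.*-zeroˡ (g (suc m)))) (ℚP.+-identityˡ ((f *S g) m)))

shift-*ʳ : ∀ f g → f *S shift g ≈ shift (f *S g)
shift-*ʳ f g = ≈-trans (*-comm f (shift g)) (≈-trans (shift-*ˡ g f) (shift-cong (*-comm g f)))

*-causal : ∀ m {f f′ g g′} → (∀ j → j ≤ m → f j ≡ f′ j) → (∀ j → j ≤ m → g j ≡ g′ j) →
           (f *S g) m ≡ (f′ *S g′) m
*-causal zero {f} {f′} {g} {g′} f≈ g≈ =
  trans (*S-coeff₀ f g) (trans (cong₂ ℚ._*_ (f≈ 0 z≤n) (g≈ 0 z≤n)) (sym (*S-coeff₀ f′ g′)))
*-causal (suc m) {f} {f′} {g} {g′} f≈ g≈ = trans (*S-coeffₛ f g m) (trans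
  (cong₂ ℚ._+_ (cong₂ ℚ._*_ (f≈ 0 z≤n) (g≈ (suc m) ℕP.≤-refl))
               (*-causal m (λ j j≤m → f≈ (suc j) (s≤s j≤m)) (λ j j≤m → g≈ j (ℕP.m≤n⇒m≤1+n j≤m))))
  (sym (*S-coeffₛ f′ g′ m)))

OneBelow : ℕ → Series → Set
OneBelow b u = ∀ j → j < b → u j ≡ 1S j

OneBelow-* : ∀ {b u} → OneBelow b u → ∀ g j → j < b → (u *S g) j ≡ g j
OneBelow-* {u = u} u≡1 g j j<b =
  trans (*-causal j {u} {1S} {g} {g} (λ i i≤j → u≡1 i (ℕP.≤-<-trans i≤j j<b)) (λ _ _ → refl))
        (*-identityˡ g j)

OneBelow-^ : ∀ {b u} → OneBelow b u → ∀ e → OneBelow b (u ^S e)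
OneBelow-^ u≡1 zero    j j<b = refl
OneBelow-^ {u = u} u≡1 (suc e) j j<b =
  trans (OneBelow-* u≡1 (u ^S e) j j<b) (OneBelow-^ u≡1 e j j<b)

tPow-below : ∀ j m → m < j → tPow j m ≡ 0ℚ
tPow-below (suc j) zero    _         = refl
tPow-below (suc j) (suc m) (s≤s m<j) = tPow-below j m m<j

oneMinusQPow-OneBelow : ∀ n → OneBelow (2 ℕ.* n) (oneMinusQPow n)
oneMinusQPow-OneBelow n j j<2n = begin
  1S j ℚ.+ (- 1ℚ) ℚ.* tPow (2 ℕ.* n) j   ≡⟨ cong (λ z → 1S j ℚ.+ (- 1ℚ) ℚ.* z) (tPow-below (2 ℕ.* n) j j<2n) ⟩
  1S j ℚ.+ (- 1ℚ) ℚ.* 0ℚ                 ≡⟨ cong (1S j ℚ.+_) (ℚP.*-zeroʳ (- 1ℚ)) ⟩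
  1S j ℚ.+ 0ℚ                            ≡⟨ ℚP.+-identityʳ (1S j) ⟩
  1S j                                   ∎
  where open ≡-Reasoning

-- Coefficient j of the truncated product ∏_{n ≤ N} (1 − q^n)^e does not
-- depend on N once N ≥ j; this is what makes Δ and Δ^(1/2) well defined.
prodS-step : ∀ e N j → j < 2 ℕ.* suc N → prodS e (suc N) j ≡ prodS e N j
prodS-step e N j = OneBelow-* (OneBelow-^ (oneMinusQPow-OneBelow (suc N)) e) (prodS e N) j

prodS-stable : ∀ e {j N} → j ≤′ N → prodS e N j ≡ prodS e j j
prodS-stable e (≤′-reflexive refl)   = refl
prodS-stable e {j} (≤′-step {N} j≤′N) =
  trans (prodS-step e N j (ℕP.<-≤-trans (s≤s (ℕP.≤′⇒≤ j≤′N)) (ℕP.m≤m+n (suc N) (suc N + 0))))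
        (prodS-stable e j≤′N)

prodS-agree : ∀ e {j N N′} → j ≤ N → j ≤ N′ → prodS e N j ≡ prodS e N′ j
prodS-agree e j≤N j≤N′ = trans (prodS-stable e (ℕP.≤⇒≤′ j≤N)) (sym (prodS-stable e (ℕP.≤⇒≤′ j≤N′)))

prodS-square : ∀ N → prodS 12 N *S prodS 12 N ≈ prodS 24 N
prodS-square zero    = *-identityˡ 1S
prodS-square (suc N) = begin
  (u *S prodS 12 N) *S (u *S prodS 12 N)         ≈⟨ *-interchange u (prodS 12 N) u (prodS 12 N) ⟩
  (u *S u) *S (prodS 12 N *S prodS 12 N)         ≈⟨ *-cong {u *S u} {v ^S 24} (^S-+ v 12 12) (prodS-square N) ⟩
  (v ^S 24) *S prodS 24 N                        ∎
  where
  open ≈-Reasoning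
  v u : Series
  v = oneMinusQPow (suc N)
  u = v ^S 12

η¹² η²⁴ : Series
η¹² m = prodS 12 (suc m) m
η²⁴ m = prodS 24 (suc (suc m)) m

Δhalf-shift : Δhalf ≈ shift η¹²
Δhalf-shift zero    = refl
Δhalf-shift (suc m) = refl

Δ-shift : Δ ≈ shift (shift η²⁴)
Δ-shift zero          = refl
Δ-shift (suc zero)    = refl
Δ-shift (suc (suc m)) = refl

η¹²-square : η¹² *S η¹² ≈ η²⁴
η¹²-square m = begin
  (η¹² *S η¹²) m                             ≡⟨ *-causal m {η¹²} {prodS 12 (suc m)} {η¹²} {prodS 12 (suc m)} agree agree ⟩
  (prodS 12 (suc m) *S prodS 12 (suc m)) m   ≡⟨ prodS-square (suc m) m ⟩
  prodS 24 (suc m) m                         ≡⟨ prodS-agree 24 {m} {suc m} {suc (suc m)} (ℕP.n≤1+n m) (ℕP.m≤n⇒m≤1+n (ℕP.n≤1+n m)) ⟩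
  η²⁴ m                                      ∎
  where
  open ≡-Reasoning
  agree : ∀ j → j ≤ m → η¹² j ≡ prodS 12 (suc m) j
  agree j j≤m = prodS-agree 12 {j} {suc j} {suc m} (ℕP.n≤1+n j) (ℕP.m≤n⇒m≤1+n j≤m)

Δhalf-square : Δhalf *S Δhalf ≈ Δ
Δhalf-square = begin
  Δhalf *S Δhalf               ≈⟨ *-cong Δhalf-shift Δhalf-shift ⟩
  shift η¹² *S shift η¹²       ≈⟨ shift-*ˡ η¹² (shift η¹²) ⟩
  shift (η¹² *S shift η¹²)     ≈⟨ shift-cong (shift-*ʳ η¹² η¹²) ⟩
  shift (shift (η¹² *S η¹²))   ≈⟨ shift-cong (shift-cong η¹²-square) ⟩
  shift (shift η²⁴)            ≈⟨ Δ-shift ⟨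
  Δ                            ∎
  where open ≈-Reasoning

-- Part 3: homogenised evaluation  hom d p X Y = Y^d p(X/Y), and degree bounds.

-- Polynomials are coefficient lists, so `length p ≤ n` says deg p < n.
length-+P : ∀ {n} p q → length p ≤ n → length q ≤ n → length (p +P q) ≤ n
length-+P []      q       _       lq      = lq
length-+P (a ∷ p) []      lp      _       = lp
length-+P (a ∷ p) (b ∷ q) (s≤s lp) (s≤s lq) = s≤s (length-+P p q lp lq)

length-polySeq : ∀ m a b c → length a ≤ c → length b ≤ suc c → ∀ k → length (polySeq m a b k) ≤ k + c
length-polySeq m a b c la lb zero          = la
length-polySeq m a b c la lb (suc zero)    = lb
length-polySeq m a b c la lb (suc (suc k)) =
  length-+P (mulX (polySeq m a b (suc k))) (scaleP (m (suc k)) (polySeq m a b k))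
    (s≤s (length-polySeq m a b c la lb (suc k)))
    (ℕP.≤-trans (ℕP.≤-reflexive (ListP.length-map (m (suc k) ℚ.*_) (polySeq m a b k)))
                (ℕP.m≤n⇒m≤1+n (ℕP.m≤n⇒m≤1+n (length-polySeq m a b c la lb k))))

module Homogenisation (X Y : Series) where

  hm : ℕ → Poly → Series
  hm d p = hom d p X Y

  hom-+P : ∀ d p q → hm d (p +P q) ≈ hm d p +S hm d q
  hom-+P d []      q       m = sym (ℚP.+-identityˡ (hm d q m))
  hom-+P d (a ∷ p) []      m = sym (ℚP.+-identityʳ (hm d (a ∷ p) m))
  hom-+P d (a ∷ p) (b ∷ q) m = trans
    (cong ((a ℚ.+ b) ℚ.* (Y ^S d) m ℚ.+_)
          (trans (*-cong (≈-refl {X}) (hom-+P (d ℕ.∸ 1) p q) m) (*-distribˡ X (hm (d ℕ.∸ 1) p) (hm (d ℕ.∸ 1) q) m)))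
    (solve 5 (λ a b y u v → (a :+ b) :* y :+ (u :+ v) := (a :* y :+ u) :+ (b :* y :+ v)) refl
       a b ((Y ^S d) m) ((X *S hm (d ℕ.∸ 1) p) m) ((X *S hm (d ℕ.∸ 1) q) m))

  hom-scaleP : ∀ d c p → hm d (scaleP c p) ≈ c •S hm d p
  hom-scaleP d c []      m = sym (ℚP.*-zeroʳ c)
  hom-scaleP d c (a ∷ p) m = trans
    (cong ((c ℚ.* a) ℚ.* (Y ^S d) m ℚ.+_)
          (trans (*-cong (≈-refl {X}) (hom-scaleP (d ℕ.∸ 1) c p) m) (*-scaleʳ c X (hm (d ℕ.∸ 1) p) m)))
    (solve 4 (λ c a y u → (c :* a) :* y :+ c :* u := c :* (a :* y :+ u)) refl
       c a ((Y ^S d) m) ((X *S hm (d ℕ.∸ 1) p) m))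

  hom-mulX : ∀ d p → hm d (mulX p) ≈ X *S hm (d ℕ.∸ 1) p
  hom-mulX d p m = trans (cong (ℚ._+ (X *S hm (d ℕ.∸ 1) p) m) (ℚP.*-zeroˡ ((Y ^S d) m)))
                         (ℚP.+-identityˡ ((X *S hm (d ℕ.∸ 1) p) m))

  hom-one : hm 0 (1ℚ ∷ []) ≈ 1S
  hom-one m = trans (cong₂ ℚ._+_ (ℚP.*-identityˡ (1S m)) (*-zeroʳ X m)) (ℚP.+-identityʳ (1S m))

  W : Series
  W = Y *S Y

  hom-+2-cons : ∀ d c {A B} → A ≈ W *S B →
                c •S (Y ^S (2 + d)) +S X *S A ≈ W *S (c •S (Y ^S d) +S X *S B)
  hom-+2-cons d c {A} {B} A≈WB = begin
    c •S (Y *S (Y *S Y ^S d)) +S X *S A   ≈⟨ +-cong (•-cong c (≈-sym (*-assoc Y Y (Y ^S d)))) (*-cong (≈-refl {X}) A≈WB) ⟩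
    c •S (W *S Y ^S d) +S X *S (W *S B)   ≈⟨ +-cong (≈-sym (*-scaleʳ c W (Y ^S d))) (*-left-comm X W B) ⟩
    W *S (c •S Y ^S d) +S W *S (X *S B)   ≈⟨ *-distribˡ W (c •S Y ^S d) (X *S B) ⟨
    W *S (c •S Y ^S d +S X *S B)          ∎
    where open ≈-Reasoning

  hom-+2 : ∀ d p → length p ≤ suc d → hm (2 + d) p ≈ W *S hm d p
  hom-+2 d       []            _       = ≈-sym (*-zeroʳ W)
  hom-+2 zero    (c ∷ [])      _       = hom-+2-cons zero c (≈-sym (*-zeroʳ W))
  hom-+2 zero    (c ∷ _ ∷ _)   (s≤s ())
  hom-+2 (suc d) (c ∷ p)       (s≤s l) = hom-+2-cons (suc d) c (hom-+2 d p l)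

  hom-polySeq : ∀ m a b d j → length (polySeq m a b j) ≤ suc d →
    hm (2 + d) (polySeq m a b (2 + j)) ≈
    X *S hm (1 + d) (polySeq m a b (1 + j)) +S m (1 + j) •S (W *S hm d (polySeq m a b j))
  hom-polySeq m a b d j deg = begin
    hm (2 + d) (mulX R₁ +P scaleP (m (1 + j)) R₀)               ≈⟨ hom-+P (2 + d) (mulX R₁) (scaleP (m (1 + j)) R₀) ⟩
    hm (2 + d) (mulX R₁) +S hm (2 + d) (scaleP (m (1 + j)) R₀)  ≈⟨ +-cong (hom-mulX (2 + d) R₁) (hom-scaleP (2 + d) (m (1 + j)) R₀) ⟩
    X *S hm (1 + d) R₁ +S m (1 + j) •S hm (2 + d) R₀            ≈⟨ +-cong (≈-refl {X *S hm (1 + d) R₁}) (•-cong (m (1 + j)) (hom-+2 d R₀ deg)) ⟩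
    X *S hm (1 + d) R₁ +S m (1 + j) •S (W *S hm d R₀)           ∎
    where
    open ≈-Reasoning
    R₀ R₁ : Poly
    R₀ = polySeq m a b j
    R₁ = polySeq m a b (1 + j)

-- Part 4: the linear form L(H, G) = H·A − G·B for fixed A, B, and the families f.

module LinearForm (A B : Series) where

  L : Series → Series → Series
  L H G = H *S A +S (- 1ℚ) •S (G *S B)

  L-cong : ∀ {H H′ G G′} → H ≈ H′ → G ≈ G′ → L H G ≈ L H′ G′
  L-cong H≈ G≈ = +-cong (*-cong H≈ (≈-refl {A})) (•-cong (- 1ℚ) (*-cong G≈ (≈-refl {B})))

  L-+ : ∀ H H′ G G′ → L (H +S H′) (G +S G′) ≈ L H G +S L H′ G′
  L-+ H H′ G G′ m = trans
    (cong₂ ℚ._+_ (*-distribʳ H H′ A m) (cong ((- 1ℚ) ℚ.*_) (*-distribʳ G G′ B m)))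
    (solve 5 (λ c a a′ b b′ → (a :+ a′) :+ c :* (b :+ b′) := (a :+ c :* b) :+ (a′ :+ c :* b′)) refl
       (- 1ℚ) ((H *S A) m) ((H′ *S A) m) ((G *S B) m) ((G′ *S B) m))

  L-• : ∀ c H G → L (c •S H) (c •S G) ≈ c •S L H G
  L-• c H G m = trans
    (cong₂ ℚ._+_ (*-scaleˡ c H A m) (cong ((- 1ℚ) ℚ.*_) (*-scaleˡ c G B m)))
    (solve 4 (λ d c a b → c :* a :+ d :* (c :* b) := c :* (a :+ d :* b)) refl
       (- 1ℚ) c ((H *S A) m) ((G *S B) m))

  L-* : ∀ Z H G → L (Z *S H) (Z *S G) ≈ Z *S L H G
  L-* Z H G = begin
    (Z *S H) *S A +S (- 1ℚ) •S ((Z *S G) *S B)   ≈⟨ +-cong (*-assoc Z H A) (•-cong (- 1ℚ) (*-assoc Z G B)) ⟩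
    Z *S (H *S A) +S (- 1ℚ) •S (Z *S (G *S B))   ≈⟨ +-cong (≈-refl {Z *S (H *S A)}) (*-scaleʳ (- 1ℚ) Z (G *S B)) ⟨
    Z *S (H *S A) +S Z *S ((- 1ℚ) •S (G *S B))   ≈⟨ *-distribˡ Z (H *S A) ((- 1ℚ) •S (G *S B)) ⟨
    Z *S L H G                                   ∎
    where open ≈-Reasoning

  L-zero : ∀ H → L H 0S ≈ H *S A
  L-zero H m = trans (cong (λ z → (H *S A) m ℚ.+ (- 1ℚ) ℚ.* z) (*-zeroˡ B m))
                     (trans (cong ((H *S A) m ℚ.+_) (ℚP.*-zeroʳ (- 1ℚ))) (ℚP.+-identityʳ ((H *S A) m)))

  L-recurrence : ∀ X W c {H₀ H₁ H₂ G₀ G₁ G₂} →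
    H₂ ≈ X *S H₁ +S c •S (W *S H₀) → G₂ ≈ X *S G₁ +S c •S (W *S G₀) →
    L H₂ G₂ ≈ X *S L H₁ G₁ +S c •S (W *S L H₀ G₀)
  L-recurrence X W c {H₀} {H₁} {H₂} {G₀} {G₁} {G₂} H-rec G-rec = begin
    L H₂ G₂                                                     ≈⟨ L-cong H-rec G-rec ⟩
    L (X *S H₁ +S c •S (W *S H₀)) (X *S G₁ +S c •S (W *S G₀))   ≈⟨ L-+ (X *S H₁) (c •S (W *S H₀)) (X *S G₁) (c •S (W *S G₀)) ⟩
    L (X *S H₁) (X *S G₁) +S L (c •S (W *S H₀)) (c •S (W *S G₀)) ≈⟨ +-cong (L-* X H₁ G₁) (L-• c (W *S H₀) (W *S G₀)) ⟩
    X *S L H₁ G₁ +S c •S L (W *S H₀) (W *S G₀)                  ≈⟨ +-cong (≈-refl {X *S L H₁ G₁}) (•-cong c (L-* W H₀ G₀)) ⟩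
    X *S L H₁ G₁ +S c •S (W *S L H₀ G₀)                         ∎
    where open ≈-Reasoning

module Family (X Y A B : Series) (m : ℕ → ℚ) where

  open Homogenisation X Y
  open LinearForm A B

  Pₘ Qₘ : ℕ → Poly
  Pₘ = polySeq m (1ℚ ∷ []) (0ℚ ∷ 1ℚ ∷ [])
  Qₘ = polySeq m []        (1ℚ ∷ [])

  Pₘ-degree : ∀ j → length (Pₘ j) ≤ suc j
  Pₘ-degree j = ℕP.≤-trans (length-polySeq m _ _ 1 ℕP.≤-refl ℕP.≤-refl j) (ℕP.≤-reflexive (ℕP.+-comm j 1))

  Qₘ-degree : ∀ j → length (Qₘ j) ≤ suc (suc j)
  Qₘ-degree j = ℕP.≤-trans (length-polySeq m _ _ 0 z≤n ℕP.≤-refl j)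
                           (ℕP.≤-trans (ℕP.≤-reflexive (ℕP.+-identityʳ j)) (ℕP.m≤n⇒m≤1+n (ℕP.n≤1+n j)))

  -- F j is f_{j+1}.
  F : ℕ → Series
  F j = L (hm j (Pₘ j)) (hm (suc j) (Qₘ j))

  F-step : ∀ j → F (2 + j) ≈ X *S F (1 + j) +S m (1 + j) •S (W *S F j)
  F-step j = L-recurrence X W (m (1 + j))
    (hom-polySeq m _ _ j j (Pₘ-degree j)) (hom-polySeq m _ _ (suc j) j (Qₘ-degree j))

  F-base : F 1 ≈ X *S F 0 +S (- 1ℚ) •S (W *S B)
  F-base = begin
    L (hm 1 (mulX H₀)) (hm 2 (1ℚ ∷ []))        ≈⟨ L-cong (hom-mulX 1 H₀) G₁≈W ⟩
    (X *S hm 0 H₀) *S A +S (- 1ℚ) •S (W *S B)  ≈⟨ +-cong (*-assoc X (hm 0 H₀) A) (≈-refl {(- 1ℚ) •S (W *S B)}) ⟩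
    X *S (hm 0 H₀ *S A) +S (- 1ℚ) •S (W *S B)  ≈⟨ +-cong (*-cong (≈-refl {X}) (L-zero (hm 0 H₀))) (≈-refl {(- 1ℚ) •S (W *S B)}) ⟨
    X *S F 0 +S (- 1ℚ) •S (W *S B)             ∎
    where
    open ≈-Reasoning
    H₀ : Poly
    H₀ = 1ℚ ∷ []
    G₁≈W : hm 2 (1ℚ ∷ []) ≈ W
    G₁≈W = ≈-trans (hom-+2 0 (1ℚ ∷ []) (s≤s z≤n)) (≈-trans (*-cong (≈-refl {W}) hom-one) (*-identityʳ W))

  F-recurrence : (f : ℕ → Series) → f 0 ≈ B → (∀ j → f (suc j) ≈ F j) → m 0 ≡ - 1ℚ →
                 ∀ k → f (2 + k) ≈ X *S f (1 + k) +S m k •S (W *S f k)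
  F-recurrence f f₀ fₛ m₀ zero = begin
    f 2                                 ≈⟨ fₛ 1 ⟩
    F 1                                 ≈⟨ F-base ⟩
    X *S F 0 +S (- 1ℚ) •S (W *S B)      ≈⟨ +-cong (*-cong (≈-refl {X}) (fₛ 0)) (λ n → cong₂ ℚ._*_ m₀ (*-cong (≈-refl {W}) f₀ n)) ⟨
    X *S f 1 +S m 0 •S (W *S f 0)       ∎
    where open ≈-Reasoning
  F-recurrence f f₀ fₛ m₀ (suc j) = begin
    f (3 + j)                                         ≈⟨ fₛ (2 + j) ⟩
    F (2 + j)                                         ≈⟨ F-step j ⟩
    X *S F (1 + j) +S m (1 + j) •S (W *S F j)         ≈⟨ +-cong (*-cong (≈-refl {X}) (fₛ (1 + j))) (•-cong (m (1 + j)) (*-cong (≈-refl {W}) (fₛ j))) ⟨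
    X *S f (2 + j) +S m (1 + j) •S (W *S f (1 + j))   ∎
    where open ≈-Reasoning

module F₆ = Family E₆ Δhalf (((+ 1) ℚ./ 240) •S D E₄) 1S μ
module F₆₊₂ = Family E₆ Δhalf ((- ((+ 1) ℚ./ 504)) •S D E₆) E₂ μ*

f6-F : ∀ j → f6 (suc j) ≈ F₆.F j
f6-F j = +-cong (≈-refl {hom j (P j) E₆ Δhalf *S (((+ 1) ℚ./ 240) •S D E₄)})
                (•-cong (- 1ℚ) (≈-sym (*-identityʳ (hom (suc j) (Q j) E₆ Δhalf))))

Y²-to-Δ : ∀ g a b c → g ≈ E₆ *S a +S c •S ((Δhalf *S Δhalf) *S b) → g ≈ E₆ *S a +S c •S (Δ *S b)
Y²-to-Δ g a b c rec = ≈-trans rec (+-cong (≈-refl {E₆ *S a}) (•-cong c (*-cong Δhalf-square (≈-refl {b}))))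

corollary3p2 : (k : ℕ) →
    ((n : ℕ) → f6 (k + 2) n ≡ (E₆ *S f6 (k + 1) +S μ k •S (Δ *S f6 k)) n)
    × ((n : ℕ) → f6+2 (k + 2) n ≡ (E₆ *S f6+2 (k + 1) +S μ* k •S (Δ *S f6+2 k)) n)
corollary3p2 k rewrite ℕP.+-comm k 2 | ℕP.+-comm k 1 =
    Y²-to-Δ (f6 (2 + k)) (f6 (1 + k)) (f6 k) (μ k) (F₆.F-recurrence f6 (≈-refl {1S}) f6-F refl k)
  , Y²-to-Δ (f6+2 (2 + k)) (f6+2 (1 + k)) (f6+2 k) (μ* k) (F₆₊₂.F-recurrence f6+2 (≈-refl {E₂}) (λ j → ≈-refl {f6+2 (suc j)}) refl k)
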